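{- Let $\mathcal{H}=\mathrm{L}(l,h,w,y)$ be a tight minimum distance diagram of area $N$ and let $m\geq1$ be an integer. Then $m\mathcal{H}=\mathrm{L}(ml,mh,mw,my)$ is tight if and only if $m\lceil\sqrt{3N}\rceil=\lceil m\sqrt{3N}\rceil$.
   Context: For integers $0\le w<l$, $0\le y<h$, the L-shape $\mathrm{L}(l,h,w,y)=\{(i,j)\in\mathbb{Z}^2:0\le i<l,0\le j<h\}\setminus\{(i,j):l-w\le i<l,h-y\le j<h\}$ has area $lh-wy$ and diameter $\mathrm{d}_{\mathrm{L}(l,h,w,y)}=l+h-\min\{w,y\}-2$. A minimum distance diagram is such an L-shape that equals the image of a minimum distance diagram map $\psi:\mathrm{G}\to\mathbb{N}^2$ of a $2$--Cayley digraph $\mathrm{Cay}(\mathrm{G},\{a,b\})$ ($\mathrm{G}$ finite Abelian generated by nonzero $a,b$; $\psi(\eta)=(i,j)$ with $ia+jb=\eta$ and $i+j$ minimal, image closed under coordinatewise smaller vectors in $\mathbb{N}^2$). Let $\mathrm{lb}(N)=\lceil\sqrt{3N}\rceil-2$. An L-shape $\mathcal{L}$ of area $N$ is tight if $\mathrm{d}_{\mathcal{L}}=\mathrm{lb}(N)$. -}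

module Defs where

open import Level using (0ℓ)
open import Data.Nat using (ℕ; zero; suc; _+_; _*_; _∸_; _≤_; _<_; _≤?_; _⊓_)
open import Data.Product using (Σ; ∃; _×_; _,_; proj₁; proj₂)
open import Relation.Nullary using (¬_; yes; no)
open import Relation.Binary.PropositionalEquality using (_≡_)
open import Function.Bundles using (_⇔_)
open import Algebra.Bundles using (AbelianGroup)

-- Ceiling of the square root on ℕ: the least k with x ≤ k * k.
-- Searched upward from 0 with fuel (x + 1 steps suffice since x ≤ x * x for x ≥ 1).
ceilSqrtFrom : ℕ → ℕ → ℕ → ℕ
ceilSqrtFrom x k zero = k
ceilSqrtFrom x k (suc fuel) with x ≤? k * k
... | yes _ = k
... | no  _ = ceilSqrtFrom x (suc k) fuel

ceilSqrt : ℕ → ℕ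
ceilSqrt x = ceilSqrtFrom x 0 (suc x)

lb : ℕ → ℕ
lb N = ceilSqrt (3 * N) ∸ 2

-- An L-shape L(l,h,w,y) (with w < l, y < h), as a subset of ℕ²
InL : ℕ → ℕ → ℕ → ℕ → ℕ × ℕ → Set
InL l h w y (i , j) = i < l × j < h × ¬ ((l ∸ w ≤ i) × (h ∸ y ≤ j))

areaL : ℕ → ℕ → ℕ → ℕ → ℕ
areaL l h w y = l * h ∸ w * y

diamL : ℕ → ℕ → ℕ → ℕ → ℕ
diamL l h w y = l + h ∸ (w ⊓ y) ∸ 2

Tight : ℕ → ℕ → ℕ → ℕ → Set
Tight l h w y = diamL l h w y ≡ lb (areaL l h w y)

module _ (G : AbelianGroup 0ℓ 0ℓ) where
  open AbelianGroup G

  infixr 8 _·_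
  _·_ : ℕ → Carrier → Carrier
  zero  · x = ε
  suc n · x = x ∙ (n · x)

  record IsMDDMap (a b : Carrier) (ψ : Carrier → ℕ × ℕ) : Set where
    field
      ψ-cong     : ∀ {η η′} → η ≈ η′ → ψ η ≡ ψ η′
      ψ-repr     : ∀ η → (proj₁ (ψ η) · a) ∙ (proj₂ (ψ η) · b) ≈ η
      ψ-minimal  : ∀ η i j → (i · a) ∙ (j · b) ≈ η → proj₁ (ψ η) + proj₂ (ψ η) ≤ i + j
      ψ-downward : ∀ η i j → i ≤ proj₁ (ψ η) → j ≤ proj₂ (ψ η) → ∃ λ η′ → ψ η′ ≡ (i , j)

-- L(l,h,w,y) is a minimum distance diagram: it equals the image of a minimum
-- distance diagram map of some 2-Cayley digraph Cay(G,{a,b}), G Abelian, a,b ≠ 0.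
-- (G is generated by a,b since ψ-repr gives every element as ia+jb; G is finite
-- since the image of ψ is the finite L-shape and ψ is injective up to ≈.)
IsMDD : ℕ → ℕ → ℕ → ℕ → Set₁
IsMDD l h w y =
  Σ (AbelianGroup 0ℓ 0ℓ) λ G →
  let open AbelianGroup G in
  Σ Carrier λ a → Σ Carrier λ b → Σ (Carrier → ℕ × ℕ) λ ψ →
    ¬ (a ≈ ε) × ¬ (b ≈ ε) × IsMDDMap G a b ψ ×
    (∀ p → InL l h w y p ⇔ (∃ λ η → ψ η ≡ p))

-- The theorem is pure arithmetic: scaling by m multiplies l + h - min{w,y} by m
-- and the area by m², and for a tight diagram l + h - min{w,y} = ⌈√(3N)⌉. Both
-- sides of each tightness equation are at least 2, so the "- 2" in lb cancels and
-- mH is tight exactly when m⌈√(3N)⌉ = ⌈√(3m²N)⌉ = ⌈m√(3N)⌉.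
module Submission where

open import Defs
open import Data.Nat using (ℕ; suc; _+_; _*_; _∸_; _⊓_; _≤_; _<_; _≤?_; z≤n; s≤s; NonZero; >-nonZero)
open import Data.Nat.Properties
open import Data.Nat.Solver using (module +-*-Solver)
open import Relation.Nullary using (yes; no)
open import Relation.Binary.PropositionalEquality using (_≡_; refl; cong; cong₂; subst; subst₂; module ≡-Reasoning)
open import Function.Bundles using (_⇔_; mk⇔; module Equivalence)

ceilSqrtFrom-≥ : ∀ x k fuel → k ≤ ceilSqrtFrom x k fuel
ceilSqrtFrom-≥ x k 0 = ≤-refl
ceilSqrtFrom-≥ x k (suc fuel) with x ≤? k * k
... | yes _ = ≤-refl
... | no  _ = ≤-trans (n≤1+n k) (ceilSqrtFrom-≥ x (suc k) fuel)

-- For x ≥ 2 the search has rejected k = 0 and k = 1 before it can stop.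
2≤ceilSqrt : ∀ {x} → 2 ≤ x → 2 ≤ ceilSqrt x
2≤ceilSqrt {1}                (s≤s ())
2≤ceilSqrt {x@(suc (suc x′))} _ = ceilSqrtFrom-≥ x 2 (suc x′)

areaL-pos : ∀ {l h w y} → w < l → y < h → 0 < areaL l h w y
areaL-pos w<l y<h = m<n⇒0<n∸m (*-mono-< w<l y<h)

2≤ceilSqrt[3*areaL] : ∀ {l h w y} → w < l → y < h → 2 ≤ ceilSqrt (3 * areaL l h w y)
2≤ceilSqrt[3*areaL] w<l y<h = 2≤ceilSqrt (≤-trans (n≤1+n 2) (*-monoʳ-≤ 3 (areaL-pos w<l y<h)))

2≤l+h∸w⊓y : ∀ {l h w y} → w < l → y < h → 2 ≤ l + h ∸ w ⊓ y
2≤l+h∸w⊓y {l} {h} {w} {y} w<l y<h =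
  m+n≤o⇒m≤o∸n 2 (subst (2 + w ⊓ y ≤_) (+-comm h l)
    (+-mono-≤ (≤-<-trans z≤n y<h) (≤-<-trans (m⊓n≤m w y) w<l)))

Tight⇔ : ∀ {l h w y} → w < l → y < h →
  Tight l h w y ⇔ (l + h ∸ w ⊓ y ≡ ceilSqrt (3 * areaL l h w y))
Tight⇔ w<l y<h =
  mk⇔ (∸-cancelʳ-≡ (2≤l+h∸w⊓y w<l y<h) (2≤ceilSqrt[3*areaL] w<l y<h)) (cong (_∸ 2))

+∸⊓-scale : ∀ m l h w y → m * l + m * h ∸ (m * w) ⊓ (m * y) ≡ m * (l + h ∸ w ⊓ y)
+∸⊓-scale m l h w y = begin
  m * l + m * h ∸ (m * w) ⊓ (m * y)  ≡⟨ cong₂ _∸_ (*-distribˡ-+ m l h) (*-distribˡ-⊓ m w y) ⟨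
  m * (l + h) ∸ m * (w ⊓ y)          ≡⟨ *-distribˡ-∸ m (l + h) (w ⊓ y) ⟨
  m * (l + h ∸ w ⊓ y)                ∎
  where open ≡-Reasoning

areaL-scale : ∀ m l h w y → areaL (m * l) (m * h) (m * w) (m * y) ≡ m * m * areaL l h w y
areaL-scale m l h w y = begin
  m * l * (m * h) ∸ m * w * (m * y)  ≡⟨ cong₂ _∸_ (square-out l h) (square-out w y) ⟩
  m * m * (l * h) ∸ m * m * (w * y)  ≡⟨ *-distribˡ-∸ (m * m) (l * h) (w * y) ⟨
  m * m * (l * h ∸ w * y)            ∎
  where
  open ≡-Reasoning
  open +-*-Solver
  square-out : ∀ a b → m * a * (m * b) ≡ m * m * (a * b)
  square-out = solve 3 (λ m a b → m :* a :* (m :* b) := m :* m :* (a :* b)) refl m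

Tight-scale⇔ : ∀ {l h w y} m .{{_ : NonZero m}} → w < l → y < h →
  Tight (m * l) (m * h) (m * w) (m * y) ⇔
  (m * (l + h ∸ w ⊓ y) ≡ ceilSqrt (3 * (m * m * areaL l h w y)))
Tight-scale⇔ {l} {h} {w} {y} m w<l y<h =
  subst₂ (λ d a → Tight (m * l) (m * h) (m * w) (m * y) ⇔ (d ≡ ceilSqrt (3 * a)))
    (+∸⊓-scale m l h w y) (areaL-scale m l h w y)
    (Tight⇔ (*-monoʳ-< m w<l) (*-monoʳ-< m y<h))

proposition2 : (l h w y N m : ℕ) → w < l → y < h →
    IsMDD l h w y → N ≡ areaL l h w y → Tight l h w y → 1 ≤ m →
    (Tight (m * l) (m * h) (m * w) (m * y) ⇔ (m * ceilSqrt (3 * N) ≡ ceilSqrt (3 * ((m * m) * N))))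
proposition2 l h w y _ m w<l y<h _ refl tight 1≤m =
  subst (λ s → Tight (m * l) (m * h) (m * w) (m * y) ⇔
               (m * s ≡ ceilSqrt (3 * (m * m * areaL l h w y))))
    (Equivalence.to (Tight⇔ w<l y<h) tight)
    (Tight-scale⇔ m {{>-nonZero 1≤m}} w<l y<h)
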